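{- Let $L,L'$ be positive integers divisible by $4$ and let $f\colon\Gamma_L\times\Gamma_{L'}\to\Sigma^2$ be an equivariant simplicial map with $\deg_1(f)=1$. Then there is a vertex $(v_1,v_2)$ of $\Gamma_L\times\Gamma_{L'}$ such that $f(v_1,v_2)$ is blue and $f(v_1+1,v_2)$ is yellow.
   Context: $\Gamma_L$ ($4\mid L$) is the order complex (simplices = weakly increasing chains, with the usual omit/repeat operations) of the poset $(\mathbb Z_L,\preccurlyeq)$ with $a\prec b$ iff $a$ even, $b$ odd and $a-b\equiv\pm1\pmod L$, with action $x\mapsto x+L/2$; products are componentwise with diagonal action. $\Sigma^2$ has vertices blue and yellow, simplices all colour tuples with at most two alternations, and action swapping colours; a simplicial map to $\Sigma^2$ is a vertex colouring such that no $3$-simplex receives an alternating colour pattern; equivariance means antipodal vertices get different colours. $Y$ is a $\mathbb Z_2$-CW complex with $2$-skeleton $|\Sigma^2|$, obtained by equivariantly attaching cells of dimension $\ge4$ so that $\pi_i(Y)=0$ for $i\ne2$ and $|\Sigma^2|\to Y$ is an isomorphism on $\pi_2$. $\deg_1(f)$ means $\deg_1$ of $j\circ|f|$ where $j$ is the inclusion $|\Sigma^2|\to Y$, and for an equivariant $g\colon|\Gamma_L\times\Gamma_{L'}|\to Y$, $\deg_1(g)=g^*(e^0)(x_1)+g^*(d^0)(b_1)\bmod 2$, using $\mathbb Z_2$-cellular cochains, $g^*$ induced by an equivariant cellular approximation of $g$, $e^0$ the $1$-cochain equal to $1$ on $[\text{blue},\text{yellow}]$ and $0$ on $[\text{yellow},\text{blue}]$,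 $d^0$ the $2$-cochain equal to $1$ on $[\text{blue},\text{yellow},\text{blue}]$ and $0$ on $[\text{yellow},\text{blue},\text{yellow}]$, $x_1$ the sum of the edges joining $(k,0)$ and $(k+1,0)$, and $b_1$ the sum of all non-degenerate $2$-simplices all of whose vertices $(a,b)$ have $b\in\{0,\dots,L'/2\}$. -}

module Defs where

open import Data.Nat using (ℕ; zero; suc; _+_; _∸_; _≡ᵇ_; _≤ᵇ_; NonZero)
open import Data.Nat.DivMod using (_%_; _/_; _mod_)
open import Data.Fin using (Fin; toℕ) renaming (zero to fzero; suc to fsuc)
open import Data.Bool using (Bool; true; false; _∧_; _∨_; not; if_then_else_)
open import Data.Product using (_×_)
open import Data.Sum using (_⊎_)
open import Relation.Binary.PropositionalEquality using (_≡_)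
import Data.Empty

-- Colours: the two vertices of Σ²
data Colour : Set where
  blue yellow : Colour

_==ᶜ_ : Colour → Colour → Bool
blue   ==ᶜ blue   = true
yellow ==ᶜ yellow = true
_      ==ᶜ _      = false

[_] : Bool → ℕ
[ true ]  = 1
[ false ] = 0

∑ : (n : ℕ) → (Fin n → ℕ) → ℕ
∑ zero    f = 0
∑ (suc n) f = f fzero + ∑ n (λ i → f (fsuc i))

-- The poset (ℤ_L, ≼) underlying Γ_L ; ℤ_L is represented by Fin L
module _ {L : ℕ} {{_ : NonZero L}} where

  _⊕_ : Fin L → ℕ → Fin L
  a ⊕ k = (toℕ a + k) mod L

  _=ᶠ_ : Fin L → Fin L → Bool
  a =ᶠ b = toℕ a ≡ᵇ toℕ b

  isEven : Fin L → Bool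
  isEven a = (toℕ a % 2) ≡ᵇ 0

  -- a ≺ b  iff  a even, b odd and a - b ≡ ±1 (mod L)
  -- (a - b ≡ -1 iff b = a + 1 ; a - b ≡ 1 iff b = a + (L - 1))
  _≺_ : Fin L → Fin L → Bool
  a ≺ b = isEven a ∧ not (isEven b) ∧ ((b =ᶠ (a ⊕ 1)) ∨ (b =ᶠ (a ⊕ (L ∸ 1))))

  _≼_ : Fin L → Fin L → Bool
  a ≼ b = (a =ᶠ b) ∨ (a ≺ b)

Colouring : ℕ → ℕ → Set
Colouring L L' = Fin L → Fin L' → Colour

Alternating : Colour → Colour → Colour → Colour → Set
Alternating c₀ c₁ c₂ c₃ =
  (c₀ ≡ blue × c₁ ≡ yellow × c₂ ≡ blue × c₃ ≡ yellow) ⊎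
  (c₀ ≡ yellow × c₁ ≡ blue × c₂ ≡ yellow × c₃ ≡ blue)

module _ {L L' : ℕ} {{_ : NonZero L}} {{_ : NonZero L'}} where

  -- simplicial map Γ_L × Γ_L' → Σ²: no 3-simplex (pair of weakly increasing
  -- chains of length 4, combined componentwise) gets an alternating pattern
  IsSimplicial : Colouring L L' → Set
  IsSimplicial f =
    (a₀ a₁ a₂ a₃ : Fin L) (b₀ b₁ b₂ b₃ : Fin L') →
    (a₀ ≼ a₁) ∧ (a₁ ≼ a₂) ∧ (a₂ ≼ a₃) ≡ true →
    (b₀ ≼ b₁) ∧ (b₁ ≼ b₂) ∧ (b₂ ≼ b₃) ≡ true →
    Alternating (f a₀ b₀) (f a₁ b₁) (f a₂ b₂) (f a₃ b₃) → Data.Empty.⊥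

  IsEquivariant : Colouring L L' → Set
  IsEquivariant f =
    (a : Fin L) (b : Fin L') → f (a ⊕ (L / 2)) (b ⊕ (L' / 2)) ≡ f a b → Data.Empty.⊥

  -- e⁰ evaluated on the image of an (oriented) edge
  e⁰ : Colour → Colour → Bool
  e⁰ c c' = (c ==ᶜ blue) ∧ (c' ==ᶜ yellow)

  -- d⁰ evaluated on the image of an (oriented) 2-simplex
  d⁰ : Colour → Colour → Colour → Bool
  d⁰ c c' c'' = (c ==ᶜ blue) ∧ (c' ==ᶜ yellow) ∧ (c'' ==ᶜ blue)

  -- f^*(e⁰)(x₁): x₁ = sum over k ∈ ℤ_L of the edge joining (k,0) and (k+1,0),
  -- oriented according to the order ≼
  e⁰x₁ : Colouring L L' → ℕ
  e⁰x₁ f = ∑ L λ k →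
    [ if k ≺ (k ⊕ 1)
        then e⁰ (f k zero') (f (k ⊕ 1) zero')
        else e⁰ (f (k ⊕ 1) zero') (f k zero') ]
    where
      zero' : Fin L'
      zero' = (0 mod L')

  -- a 2-simplex of Γ_L × Γ_L' is a pair of weakly increasing 3-chains; it is
  -- non-degenerate iff no two consecutive vertices coincide
  NonDeg2 : (a₀ a₁ a₂ : Fin L) (b₀ b₁ b₂ : Fin L') → Bool
  NonDeg2 a₀ a₁ a₂ b₀ b₁ b₂ =
    (a₀ ≼ a₁) ∧ (a₁ ≼ a₂) ∧ (b₀ ≼ b₁) ∧ (b₁ ≼ b₂) ∧
    not ((a₀ =ᶠ a₁) ∧ (b₀ =ᶠ b₁)) ∧ not ((a₁ =ᶠ a₂) ∧ (b₁ =ᶠ b₂))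

  inHalf : Fin L' → Bool
  inHalf b = toℕ b ≤ᵇ (L' / 2)

  d⁰b₁ : Colouring L L' → ℕ
  d⁰b₁ f =
    ∑ L λ a₀ → ∑ L λ a₁ → ∑ L λ a₂ → ∑ L' λ b₀ → ∑ L' λ b₁ → ∑ L' λ b₂ →
    [ NonDeg2 a₀ a₁ a₂ b₀ b₁ b₂ ∧ inHalf b₀ ∧ inHalf b₁ ∧ inHalf b₂ ∧
      d⁰ (f a₀ b₀) (f a₁ b₁) (f a₂ b₂) ]

  deg₁ : Colouring L L' → ℕ
  deg₁ f = (e⁰x₁ f + d⁰b₁ f) % 2

{-# OPTIONS --safe #-}
-- A nonzero term of deg₁ f exhibits two differently coloured vertices in a
-- common row Γ_L × {v}: for e⁰(x₁) this is an edge of row 0, and for d⁰(b₁) a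
-- non-degenerate 2-simplex coloured blue, yellow, blue whose second coordinates
-- form a chain b₀ ≼ b₁ ≼ b₂, which has a repetition because ≺ only goes from
-- even to odd elements. Walking around the cycle ℤ_L from a blue vertex of
-- that row to a yellow one, some step goes from blue to yellow.
module Submission where

open import Defs
open import Data.Nat using (ℕ; NonZero; zero; suc; _+_; _∸_)
open import Data.Nat.Properties using (≡ᵇ⇒≡; 0≢1+n; m+[n∸m]≡n; +-assoc; +-comm; +-identityʳ)
open import Data.Nat.DivMod using (_%_; %-distribˡ-+; m%n%n≡m%n; m<n⇒m%n≡m; [m+n]%n≡m%n; m%n<n)
open import Data.Nat.Divisibility using (_∣_)
open import Data.Fin using (Fin; toℕ)
open import Data.Fin.Properties using (toℕ-injective; toℕ-fromℕ<; toℕ<n; toℕ≤n)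
open import Data.Bool using (true; false; _∧_; not; if_then_else_)
open import Data.Bool.Properties using (∧-conicalˡ; ∧-conicalʳ; not-¬; T-≡)
open import Data.Empty using (⊥-elim)
open import Data.Sum using (_⊎_; inj₁; inj₂)
open import Data.Product using (Σ; Σ-syntax; _×_; _,_)
open import Function.Bundles using (Equivalence)
open import Relation.Binary.PropositionalEquality
  using (_≡_; _≢_; refl; sym; trans; cong; ≢-sym; module ≡-Reasoning)

blue≢yellow : blue ≢ yellow
blue≢yellow ()

m+n≢0⇒m≢0⊎n≢0 : ∀ m n → m + n ≢ 0 → m ≢ 0 ⊎ n ≢ 0
m+n≢0⇒m≢0⊎n≢0 zero    n n≢0 = inj₂ n≢0
m+n≢0⇒m≢0⊎n≢0 (suc m) n _   = inj₁ λ ()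

m%2≡1⇒m≢0 : ∀ m → m % 2 ≡ 1 → m ≢ 0
m%2≡1⇒m≢0 .0 () refl

∑≢0⇒∃≢0 : ∀ n (g : Fin n → ℕ) → ∑ n g ≢ 0 → Σ[ i ∈ Fin n ] g i ≢ 0
∑≢0⇒∃≢0 zero    g ∑≢0 = ⊥-elim (∑≢0 refl)
∑≢0⇒∃≢0 (suc n) g ∑≢0 with g Fin.zero in g0
... | suc _ = Fin.zero , λ g0≡0 → 0≢1+n (trans (sym g0≡0) g0)
... | zero  with ∑≢0⇒∃≢0 n (λ i → g (Fin.suc i)) ∑≢0
...   | i , gi≢0 = Fin.suc i , gi≢0

[b]≢0⇒b≡true : ∀ b → [ b ] ≢ 0 → b ≡ true
[b]≢0⇒b≡true true  _   = refl
[b]≢0⇒b≡true false [b]≢0 = ⊥-elim ([b]≢0 refl)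

step-in-sequence : (g : ℕ → Colour) (n : ℕ) → g 0 ≡ blue → g n ≡ yellow →
                   Σ[ k ∈ ℕ ] g k ≡ blue × g (suc k) ≡ yellow
step-in-sequence g zero    g0 gn = ⊥-elim (blue≢yellow (trans (sym g0) gn))
step-in-sequence g (suc n) g0 gn with g n in gn-1
... | blue   = n , gn-1 , gn
... | yellow = step-in-sequence g n g0 gn-1

module _ {L : ℕ} {{_ : NonZero L}} where

  toℕ-⊕ : ∀ (a : Fin L) k → toℕ (a ⊕ k) ≡ (toℕ a + k) % L
  toℕ-⊕ a k = toℕ-fromℕ< (m%n<n (toℕ a + k) L)

  ⊕-identityʳ : ∀ (a : Fin L) → a ⊕ 0 ≡ a
  ⊕-identityʳ a = toℕ-injective (begin
    toℕ (a ⊕ 0)      ≡⟨ toℕ-⊕ a 0 ⟩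
    (toℕ a + 0) % L  ≡⟨ cong (_% L) (+-identityʳ (toℕ a)) ⟩
    toℕ a % L        ≡⟨ m<n⇒m%n≡m (toℕ<n a) ⟩
    toℕ a            ∎)
    where open ≡-Reasoning

  ⊕-suc : ∀ (a : Fin L) k → (a ⊕ k) ⊕ 1 ≡ a ⊕ suc k
  ⊕-suc a k = toℕ-injective (begin
    toℕ ((a ⊕ k) ⊕ 1)                  ≡⟨ toℕ-⊕ (a ⊕ k) 1 ⟩
    (toℕ (a ⊕ k) + 1) % L              ≡⟨ cong (λ m → (m + 1) % L) (toℕ-⊕ a k) ⟩
    ((toℕ a + k) % L + 1) % L          ≡⟨ %-distribˡ-+ ((toℕ a + k) % L) 1 L ⟩
    ((toℕ a + k) % L % L + 1 % L) % L  ≡⟨ cong (λ m → (m + 1 % L) % L) (m%n%n≡m%n (toℕ a + k) L) ⟩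
    ((toℕ a + k) % L + 1 % L) % L      ≡⟨ %-distribˡ-+ (toℕ a + k) 1 L ⟨
    (toℕ a + k + 1) % L                ≡⟨ cong (_% L) (+-assoc (toℕ a) k 1) ⟩
    (toℕ a + (k + 1)) % L              ≡⟨ cong (λ m → (toℕ a + m) % L) (+-comm k 1) ⟩
    (toℕ a + suc k) % L                ≡⟨ toℕ-⊕ a (suc k) ⟨
    toℕ (a ⊕ suc k)                    ∎)
    where open ≡-Reasoning

  ⊕-reaches : ∀ (x y : Fin L) → x ⊕ (L ∸ toℕ x + toℕ y) ≡ y
  ⊕-reaches x y = toℕ-injective (begin
    toℕ (x ⊕ (L ∸ toℕ x + toℕ y))          ≡⟨ toℕ-⊕ x (L ∸ toℕ x + toℕ y) ⟩
    (toℕ x + (L ∸ toℕ x + toℕ y)) % L      ≡⟨ cong (_% L) (+-assoc (toℕ x) (L ∸ toℕ x) (toℕ y)) ⟨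
    (toℕ x + (L ∸ toℕ x) + toℕ y) % L      ≡⟨ cong (λ m → (m + toℕ y) % L) (m+[n∸m]≡n (toℕ≤n x)) ⟩
    (L + toℕ y) % L                        ≡⟨ cong (_% L) (+-comm L (toℕ y)) ⟩
    (toℕ y + L) % L                        ≡⟨ [m+n]%n≡m%n (toℕ y) L ⟩
    toℕ y % L                              ≡⟨ m<n⇒m%n≡m (toℕ<n y) ⟩
    toℕ y                                  ∎)
    where open ≡-Reasoning

  blue-yellow-step : (h : Fin L → Colour) {x y : Fin L} → h x ≡ blue → h y ≡ yellow →
                     Σ[ k ∈ Fin L ] h k ≡ blue × h (k ⊕ 1) ≡ yellow
  blue-yellow-step h {x} {y} hx hy =
    let k , hk , hk+1 = step-in-sequence (λ i → h (x ⊕ i)) (L ∸ toℕ x + toℕ y)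
                          (trans (cong h (⊕-identityʳ x)) hx)
                          (trans (cong h (⊕-reaches x y)) hy)
    in x ⊕ k , hk , trans (cong h (⊕-suc x k)) hk+1

  two-coloured⇒blue-yellow-step : (h : Fin L → Colour) {x y : Fin L} → h x ≢ h y →
                                  Σ[ k ∈ Fin L ] h k ≡ blue × h (k ⊕ 1) ≡ yellow
  two-coloured⇒blue-yellow-step h {x} {y} hx≢hy with h x in hx | h y in hy
  ... | blue   | yellow = blue-yellow-step h hx hy
  ... | yellow | blue   = blue-yellow-step h hy hx
  ... | blue   | blue   = ⊥-elim (hx≢hy refl)
  ... | yellow | yellow = ⊥-elim (hx≢hy refl)

  =ᶠ⇒≡ : ∀ {a b : Fin L} → (a =ᶠ b) ≡ true → a ≡ b
  =ᶠ⇒≡ {a} {b} eq = toℕ-injective (≡ᵇ⇒≡ (toℕ a) (toℕ b) (Equivalence.from T-≡ eq))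

  ≼⇒≡⊎≺ : ∀ {a b : Fin L} → (a ≼ b) ≡ true → a ≡ b ⊎ (a ≺ b) ≡ true
  ≼⇒≡⊎≺ {a} {b} a≼b with a =ᶠ b in eq
  ... | true  = inj₁ (=ᶠ⇒≡ eq)
  ... | false = inj₂ a≼b

  ≼-chain-repeats : ∀ {a b c : Fin L} → (a ≼ b) ≡ true → (b ≼ c) ≡ true → a ≡ b ⊎ b ≡ c
  ≼-chain-repeats {a} {b} a≼b b≼c with ≼⇒≡⊎≺ a≼b | ≼⇒≡⊎≺ b≼c
  ... | inj₁ a≡b | _        = inj₁ a≡b
  ... | inj₂ _   | inj₁ b≡c = inj₂ b≡c
  ... | inj₂ a≺b | inj₂ b≺c = ⊥-elim (not-¬ (sym b-even) (sym b-odd))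
    where
    b-even : isEven b ≡ true
    b-even = ∧-conicalˡ (isEven b) _ b≺c
    b-odd : not (isEven b) ≡ true
    b-odd = ∧-conicalˡ (not (isEven b)) _ (∧-conicalʳ (isEven a) _ a≺b)

module _ {L L' : ℕ} {{_ : NonZero L}} {{_ : NonZero L'}} where

  e⁰≡true⇒≢ : ∀ {c c'} → e⁰ {L} {L'} c c' ≡ true → c ≢ c'
  e⁰≡true⇒≢ {blue}   {yellow} _ = λ ()
  e⁰≡true⇒≢ {blue}   {blue}   ()
  e⁰≡true⇒≢ {yellow} {_}      ()

  d⁰≡true⇒≢ : ∀ {c₀ c₁ c₂} → d⁰ {L} {L'} c₀ c₁ c₂ ≡ true → c₀ ≢ c₁ × c₁ ≢ c₂
  d⁰≡true⇒≢ {blue}   {yellow} {blue}   _ = (λ ()) , (λ ())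
  d⁰≡true⇒≢ {blue}   {yellow} {yellow} ()
  d⁰≡true⇒≢ {blue}   {blue}   {_}      ()
  d⁰≡true⇒≢ {yellow} {_}      {_}      ()

  oriented-e⁰≢0⇒≢ : ∀ β c c' → [ if β then e⁰ {L} {L'} c c' else e⁰ {L} {L'} c' c ] ≢ 0 → c ≢ c'
  oriented-e⁰≢0⇒≢ true  c c' e≢0 = e⁰≡true⇒≢ ([b]≢0⇒b≡true _ e≢0)
  oriented-e⁰≢0⇒≢ false c c' e≢0 = ≢-sym (e⁰≡true⇒≢ ([b]≢0⇒b≡true _ e≢0))

  NonDeg2⇒second-coordinates-repeat : (a₀ a₁ a₂ : Fin L) (b₀ b₁ b₂ : Fin L') →
                                      NonDeg2 a₀ a₁ a₂ b₀ b₁ b₂ ≡ true → b₀ ≡ b₁ ⊎ b₁ ≡ b₂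
  NonDeg2⇒second-coordinates-repeat a₀ a₁ a₂ b₀ b₁ b₂ nd =
    ≼-chain-repeats b₀≼b₁ b₁≼b₂
    where
    b₀≼b₁ : (b₀ ≼ b₁) ≡ true
    b₀≼b₁ = ∧-conicalˡ (b₀ ≼ b₁) _ (∧-conicalʳ (a₁ ≼ a₂) _ (∧-conicalʳ (a₀ ≼ a₁) _ nd))
    b₁≼b₂ : (b₁ ≼ b₂) ≡ true
    b₁≼b₂ = ∧-conicalˡ (b₁ ≼ b₂) _
              (∧-conicalʳ (b₀ ≼ b₁) _ (∧-conicalʳ (a₁ ≼ a₂) _ (∧-conicalʳ (a₀ ≼ a₁) _ nd)))

  TwoColouredRow : Colouring L L' → Set
  TwoColouredRow f = Σ[ v ∈ Fin L' ] Σ[ x ∈ Fin L ] Σ[ y ∈ Fin L ] f x v ≢ f y v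

  e⁰x₁≢0⇒two-coloured-row : (f : Colouring L L') → e⁰x₁ f ≢ 0 → TwoColouredRow f
  e⁰x₁≢0⇒two-coloured-row f e⁰x₁≢0 =
    let k , edge≢0 = ∑≢0⇒∃≢0 L _ e⁰x₁≢0
    in _ , k , k ⊕ 1 , oriented-e⁰≢0⇒≢ (k ≺ (k ⊕ 1)) _ _ edge≢0

  d⁰≡true⇒two-coloured-row : (f : Colouring L L') (a₀ a₁ a₂ : Fin L) (b₀ b₁ b₂ : Fin L') →
                              NonDeg2 a₀ a₁ a₂ b₀ b₁ b₂ ≡ true →
                              d⁰ {L} {L'} (f a₀ b₀) (f a₁ b₁) (f a₂ b₂) ≡ true → TwoColouredRow f
  d⁰≡true⇒two-coloured-row f a₀ a₁ a₂ b₀ b₁ b₂ nd d⁰≡true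
    with NonDeg2⇒second-coordinates-repeat a₀ a₁ a₂ b₀ b₁ b₂ nd | d⁰≡true⇒≢ {f a₀ b₀} {f a₁ b₁} {f a₂ b₂} d⁰≡true
  ... | inj₁ refl | c₀≢c₁ , _     = b₀ , a₀ , a₁ , c₀≢c₁
  ... | inj₂ refl | _     , c₁≢c₂ = b₁ , a₁ , a₂ , c₁≢c₂

  d⁰b₁≢0⇒two-coloured-row : (f : Colouring L L') → d⁰b₁ f ≢ 0 → TwoColouredRow f
  d⁰b₁≢0⇒two-coloured-row f d⁰b₁≢0 =
    let a₀ , s₀ = ∑≢0⇒∃≢0 L  _ d⁰b₁≢0
        a₁ , s₁ = ∑≢0⇒∃≢0 L  _ s₀
        a₂ , s₂ = ∑≢0⇒∃≢0 L  _ s₁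
        b₀ , s₃ = ∑≢0⇒∃≢0 L' _ s₂
        b₁ , s₄ = ∑≢0⇒∃≢0 L' _ s₃
        b₂ , s₅ = ∑≢0⇒∃≢0 L' _ s₄
        nd = NonDeg2 a₀ a₁ a₂ b₀ b₁ b₂
        summand = [b]≢0⇒b≡true _ s₅
        in-half-and-d⁰ = ∧-conicalʳ nd _ summand
    in d⁰≡true⇒two-coloured-row f a₀ a₁ a₂ b₀ b₁ b₂ (∧-conicalˡ nd _ summand)
         (∧-conicalʳ (inHalf {L} b₂) _ (∧-conicalʳ (inHalf {L} b₁) _ (∧-conicalʳ (inHalf {L} b₀) _ in-half-and-d⁰)))

  deg₁≡1⇒two-coloured-row : (f : Colouring L L') → deg₁ f ≡ 1 → TwoColouredRow f
  deg₁≡1⇒two-coloured-row f deg₁≡1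
    with m+n≢0⇒m≢0⊎n≢0 (e⁰x₁ f) (d⁰b₁ f) (m%2≡1⇒m≢0 (e⁰x₁ f + d⁰b₁ f) deg₁≡1)
  ... | inj₁ e⁰x₁≢0 = e⁰x₁≢0⇒two-coloured-row f e⁰x₁≢0
  ... | inj₂ d⁰b₁≢0 = d⁰b₁≢0⇒two-coloured-row f d⁰b₁≢0

lemma4p8 : (L L' : ℕ) {{_ : NonZero L}} {{_ : NonZero L'}} →
    4 ∣ L → 4 ∣ L' →
    (f : Colouring L L') → IsSimplicial f → IsEquivariant f →
    deg₁ f ≡ 1 →
    Σ (Fin L) λ v₁ → Σ (Fin L') λ v₂ → f v₁ v₂ ≡ blue × f (v₁ ⊕ 1) v₂ ≡ yellow
lemma4p8 L L' _ _ f _ _ deg₁≡1 =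
  let v , x , y , fxv≢fyv = deg₁≡1⇒two-coloured-row f deg₁≡1
      k , blue-at-k , yellow-at-k+1 = two-coloured⇒blue-yellow-step (λ a → f a v) fxv≢fyv
  in k , v , blue-at-k , yellow-at-k+1
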